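{- Let $\alpha$ be a composition of $n$ and $\sigma\in\mathfrak{S}_{\ell(\alpha)}$. For each $1\le i\le n-1$, the operator $\pi_i$ maps $\mathrm{SPCT}^\sigma(\alpha)$ into $\mathrm{SPCT}^\sigma(\alpha)\cup\{0\}$, and, extended linearly to the $\mathbb{C}$-span of $\mathrm{SPCT}^\sigma(\alpha)$, the operators $\pi_1,\dots,\pi_{n-1}$ satisfy the relations of the $0$-Hecke algebra $H_n(0)$: $\pi_i^2=\pi_i$ for $1\le i\le n-1$, $\pi_i\pi_{i+1}\pi_i=\pi_{i+1}\pi_i\pi_{i+1}$ for $1\le i\le n-2$, and $\pi_i\pi_j=\pi_j\pi_i$ for $|i-j|\ge 2$. Thus they define an action of $H_n(0)$ (with $T_i$ acting as $\pi_i$) on the span of $\mathrm{SPCT}^\sigma(\alpha)$.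
   Context: A composition $\alpha=(\alpha_1,\dots,\alpha_k)$ of $n$ is a sequence of positive integers with sum $n$; $\ell(\alpha)=k$. Its composition diagram is the left-justified array whose $i$-th row from the top has $\alpha_i$ cells. The standardization $\mathrm{stan}(w)$ of a word $w_1\cdots w_m$ of positive integers is the unique $\pi\in\mathfrak{S}_m$ with $\pi(i)>\pi(j)$ iff $w_i>w_j$ for $i<j$. For $\sigma\in\mathfrak{S}_{\ell(\alpha)}$, a permuted composition tableau of shape $\alpha$ and type $\sigma$ is a filling of the diagram of $\alpha$ with positive integers such that: the first-column entries are distinct and the standardization of the first column read top to bottom is $\sigma$; rows weakly decrease left to right; and (triple condition) whenever $i<r$ and cells $(i,j),(i,j+1),(r,j+1)$ lie in the diagram with entries $a,b,c$, $a\ge c$ implies $b>c$. $\mathrm{SPCT}^\sigma(\alpha)$ denotes those such fillings whose entries are distinct and at most $n$ (so the entries are exactly $1,\dots,n$). For $\tau\in\mathrm{SPCT}^\sigma(\alpha)$ and $1\le i\le n-1$: $i$ is a descent of $\tau$ ($i\in\mathrm{des}(\tau)$) if $i+1$ lies in a column weakly to the right of the column of $i$. The entries $i,i+1$ are attacking if either they lie in the same column, or $i+1$ lies in the column immediately to the right of the column of $i$ and in a row strictly below the row of $i$. Let $s_i(\tau)$ be the filling obtained by swapping the positions of $i$ and $i+1$. Define $\pi_i(\tau)=\tau$ if $i\notin\mathrm{des}(\tau)$; $\pi_i(\tau)=0$ if $i\in\mathrm{des}(\tau)$ and $i,i+1$ are attacking; $\pi_i(\tau)=s_i(\tau)$ if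 $i\in\mathrm{des}(\tau)$ and $i,i+1$ are not attacking. The $0$-Hecke algebra $H_n(0)$ is the $\mathbb{C}$-algebra generated by $T_1,\dots,T_{n-1}$ subject to $T_i^2=T_i$, $T_iT_{i+1}T_i=T_{i+1}T_iT_{i+1}$, and $T_iT_j=T_jT_i$ for $|i-j|\ge2$. -}

module Defs where

open import Data.Nat using (ℕ; zero; suc; _+_; _∸_; _≤_; _<_; _≥_; _>_; _≡ᵇ_; _≤ᵇ_; _<ᵇ_)
open import Data.Bool using (Bool; true; false; if_then_else_; _∨_; _∧_)
open import Data.List using (List; []; _∷_; map; length; concat; upTo)
open import Data.Nat.ListAction using (sum)
open import Data.List.Relation.Unary.All using (All)
open import Data.List.Relation.Binary.Permutation.Propositional using (_↭_)
open import Data.Maybe using (Maybe; just; nothing; _>>=_)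
open import Data.Product using (_×_; _,_)
open import Data.Fin using (Fin; toℕ)
import Data.Fin as F
open import Data.Fin.Permutation using (Permutation′; _⟨$⟩ʳ_)
open import Relation.Binary.PropositionalEquality using (_≡_; _≢_)
open import Function.Bundles using (_⇔_)

IsComposition : ℕ → List ℕ → Set
IsComposition n α = All (λ a → 0 < a) α × sum α ≡ n

-- Fillings: list of rows (top to bottom), each row read left to right.
Filling : Set
Filling = List (List ℕ)

at : {A : Set} → List A → ℕ → Maybe A
at []       _       = nothing
at (x ∷ xs) zero    = just x
at (x ∷ xs) (suc k) = at xs k

-- entry in row r, column c (both 0-based)
entry : Filling → ℕ → ℕ → Maybe ℕ
entry τ r c = at τ r >>= λ row → at row c

record IsSPCT (α : List ℕ) (σ : Permutation′ (length α)) (τ : Filling) : Set where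
  field
    shape     : map length τ ≡ α
    standard  : concat τ ↭ map suc (upTo (sum α))
    firstDistinct : ∀ (i j : Fin (length α)) (a b : ℕ) → i F.< j →
                  entry τ (toℕ i) 0 ≡ just a → entry τ (toℕ j) 0 ≡ just b → a ≢ b
    firstStan : ∀ (i j : Fin (length α)) (a b : ℕ) → i F.< j →
                  entry τ (toℕ i) 0 ≡ just a → entry τ (toℕ j) 0 ≡ just b →
                  ((σ ⟨$⟩ʳ j) F.< (σ ⟨$⟩ʳ i) ⇔ b < a)
    rowsDecr  : ∀ (r c a b : ℕ) → entry τ r c ≡ just a → entry τ r (suc c) ≡ just b → b ≤ a
    triple    : ∀ (i r j a b c : ℕ) → i < r →
                  entry τ i j ≡ just a → entry τ i (suc j) ≡ just b → entry τ r (suc j) ≡ just c →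
                  a ≥ c → b > c

findIdx : (ℕ → Bool) → List ℕ → Maybe ℕ
findIdx p []       = nothing
findIdx p (x ∷ xs) = if p x then just 0 else (findIdx p xs >>= λ k → just (suc k))

pos : ℕ → Filling → Maybe (ℕ × ℕ)
pos v []           = nothing
pos v (row ∷ rows) with findIdx (λ x → x ≡ᵇ v) row
... | just c  = just (0 , c)
... | nothing = pos v rows >>= λ { (r , c) → just (suc r , c) }

swapVal : ℕ → ℕ → ℕ
swapVal i x = if x ≡ᵇ i then suc i else (if x ≡ᵇ suc i then i else x)

sOp : ℕ → Filling → Filling
sOp i τ = map (map (swapVal i)) τ

-- π_i; 'nothing' represents 0
πOp : ℕ → Filling → Maybe Filling
πOp i τ with pos i τ | pos (suc i) τ
... | just (r , c) | just (r' , c') =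
      if c ≤ᵇ c'                                             -- i is a descent
      then (if (c ≡ᵇ c') ∨ ((c' ≡ᵇ suc c) ∧ (r <ᵇ r'))         -- attacking
            then nothing
            else just (sOp i τ))
      else just τ
... | _ | _ = just τ

-- composition of operators on basis-or-zero (linear extension, 0 ↦ 0)
_∘π_ : (Filling → Maybe Filling) → (Filling → Maybe Filling) → Filling → Maybe Filling
(f ∘π g) τ = g τ >>= f

-- π_k sees a filling only through the cells P and Q of k and k+1: it fixes the filling when
-- Q lies strictly left of P, kills it when P and Q are attacking, and otherwise exchanges k and
-- k+1.  An exchange happens only when P lies strictly left of Q without attacking it, and then
-- no condition of a permuted composition tableau compares the two exchanged entries in a way
-- that the exchange would break, so SPCT^σ(α) is closed under π_k.  After an exchange k+1 lies
-- left of k, so a second π_k fixes (idempotence); π_i and π_j with |i - j| ≥ 2 move disjoint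
-- pairs of values without disturbing each other's cells (commutation).  For the braid relation,
-- both sides only depend on how π acts on the ordered pairs among the cells of i, i+1, i+2, that
-- is, on the relative columns of these cells and on which pairs attack.  This reduces the
-- relation to a model whose states are the six elements of S₃, and the model is checked by
-- evaluation on every configuration of columns and attacks.
module Submission where

open import Data.Bool using (Bool; true; false; if_then_else_; T; _∧_; _∨_)
open import Data.Bool.Properties using (T-∧)
open import Data.Empty using (⊥-elim)
open import Data.Fin.Permutation using (Permutation′)
open import Data.List using (List; []; _∷_; _++_; map; concat; length; iterate; applyUpTo; upTo)
open import Data.List.Membership.Propositional using (_∈_; _∉_)
open import Data.List.Membership.Propositional.Properties using (∈-++⁺ˡ; ∈-++⁺ʳ; ∈-++⁻)
open import Data.List.Properties using (map-cong; map-∘; map-id; map-upTo; length-map; concat-map)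
import Data.List.Relation.Unary.All as All
import Data.List.Relation.Unary.All.Properties as All
open import Data.List.Relation.Unary.AllPairs using ([]; _∷_)
open import Data.List.Relation.Unary.Any using (here; there)
open import Data.List.Relation.Unary.Unique.Propositional using (Unique)
import Data.List.Relation.Unary.Unique.Propositional.Properties as Unique
open import Data.List.Relation.Binary.Permutation.Propositional
  using (_↭_; ↭-refl; ↭-sym; prep; ↭⇒↭ₛ; module PermutationReasoning) renaming (swap to ↭-swap)
import Data.List.Relation.Binary.Permutation.Propositional.Properties as ↭
open import Data.List.Relation.Binary.Permutation.Setoid.Properties using (Unique-resp-↭)
open import Data.Maybe using (Maybe; just; nothing; _>>=_)
import Data.Maybe as Maybe
import Data.Maybe.Properties as Maybe
open import Data.Nat using (ℕ; zero; suc; _+_; _∸_; _≤_; _<_; _≡ᵇ_; _≤ᵇ_; _<ᵇ_; z≤n; s≤s)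
open import Data.Nat.ListAction using (sum)
open import Data.Nat.Properties
open import Data.Product using (_×_; _,_; proj₁; proj₂; ∃)
open import Data.Sum using (_⊎_; inj₁; inj₂)
open import Function using (_∘_; id)
open import Function.Bundles using (mk⇔; Equivalence)
open import Relation.Binary.Definitions using (DecidableEquality; tri<; tri≈; tri>)
open import Relation.Binary.PropositionalEquality
open import Relation.Nullary using (¬_; yes; no; isYes)
open import Relation.Nullary.Decidable using (map′; toWitness)

open import Defs

T⇒≡true : ∀ {b} → T b → b ≡ true
T⇒≡true {true} _ = refl

¬T⇒≡false : ∀ {b} → ¬ T b → b ≡ false
¬T⇒≡false {false} _  = refl
¬T⇒≡false {true}  ¬t = ⊥-elim (¬t _)

≡ᵇ-true : ∀ {m n} → m ≡ n → (m ≡ᵇ n) ≡ true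
≡ᵇ-true {m} {n} m≡n = T⇒≡true (≡⇒≡ᵇ m n m≡n)

≡ᵇ-false : ∀ {m n} → m ≢ n → (m ≡ᵇ n) ≡ false
≡ᵇ-false {m} {n} m≢n = ¬T⇒≡false (m≢n ∘ ≡ᵇ⇒≡ m n)

≤ᵇ-true : ∀ {m n} → m ≤ n → (m ≤ᵇ n) ≡ true
≤ᵇ-true m≤n = T⇒≡true (≤⇒≤ᵇ m≤n)

≤ᵇ-false : ∀ {m n} → n < m → (m ≤ᵇ n) ≡ false
≤ᵇ-false {m} {n} n<m = ¬T⇒≡false (<⇒≱ n<m ∘ ≤ᵇ⇒≤ m n)

data SwapView (k x : ℕ) : Set where
  lower   : x ≡ k → SwapView k x
  upper   : x ≡ suc k → SwapView k x
  outside : x ≢ k → x ≢ suc k → SwapView k x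

swapView : ∀ k x → SwapView k x
swapView k x with x ≟ k | x ≟ suc k
... | yes x≡k | _         = lower x≡k
... | no _    | yes x≡k+1 = upper x≡k+1
... | no x≢k  | no x≢k+1  = outside x≢k x≢k+1

swapVal-lower : ∀ k → swapVal k k ≡ suc k
swapVal-lower k rewrite ≡ᵇ-true {k} refl = refl

swapVal-upper : ∀ k → swapVal k (suc k) ≡ k
swapVal-upper k rewrite ≡ᵇ-false (1+n≢n {k}) | ≡ᵇ-true {suc k} refl = refl

swapVal-outside : ∀ {k x} → x ≢ k → x ≢ suc k → swapVal k x ≡ x
swapVal-outside x≢k x≢k+1 rewrite ≡ᵇ-false x≢k | ≡ᵇ-false x≢k+1 = refl

swapVal-below : ∀ {k x} → x < k → swapVal k x ≡ x
swapVal-below x<k = swapVal-outside (<⇒≢ x<k) (<⇒≢ (m<n⇒m<1+n x<k))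

swapVal-above : ∀ {k x} → suc k < x → swapVal k x ≡ x
swapVal-above k+1<x = swapVal-outside (>⇒≢ (<-trans (n<1+n _) k+1<x)) (>⇒≢ k+1<x)

swapVal-involutive : ∀ k x → swapVal k (swapVal k x) ≡ x
swapVal-involutive k x with swapView k x
... | lower refl rewrite swapVal-lower k = swapVal-upper k
... | upper refl rewrite swapVal-upper k = swapVal-lower k
... | outside x≢k x≢k+1 rewrite swapVal-outside x≢k x≢k+1 = swapVal-outside x≢k x≢k+1

swapVal-<-mono : ∀ k {x y} → x < y → ¬ (x ≡ k × y ≡ suc k) → swapVal k x < swapVal k y
swapVal-<-mono k {x} {y} x<y not-k,k+1 with swapView k x | swapView k y
... | lower refl | lower refl        = ⊥-elim (<-irrefl refl x<y)
... | lower refl | upper refl        = ⊥-elim (not-k,k+1 (refl , refl))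
... | lower refl | outside _ y≢k+1   rewrite swapVal-lower k | swapVal-outside (>⇒≢ x<y) y≢k+1 =
  ≤∧≢⇒< x<y (≢-sym y≢k+1)
... | upper refl | lower refl        = ⊥-elim (<-asym x<y (n<1+n k))
... | upper refl | upper refl        = ⊥-elim (<-irrefl refl x<y)
... | upper refl | outside y≢k y≢k+1 rewrite swapVal-upper k | swapVal-outside y≢k y≢k+1 =
  <-trans (n<1+n k) x<y
... | outside x≢k x≢k+1 | lower refl rewrite swapVal-outside x≢k x≢k+1 | swapVal-lower k =
  <-trans x<y (n<1+n k)
... | outside x≢k x≢k+1 | upper refl rewrite swapVal-outside x≢k x≢k+1 | swapVal-upper k =
  ≤∧≢⇒< (≤-pred x<y) x≢k
... | outside x≢k x≢k+1 | outside y≢k y≢k+1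
    rewrite swapVal-outside x≢k x≢k+1 | swapVal-outside y≢k y≢k+1 = x<y

Apart : ℕ → ℕ → Set
Apart i j = i + 2 ≤ j ⊎ j + 2 ≤ i

apart-sym : ∀ {i j} → Apart i j → Apart j i
apart-sym (inj₁ i+2≤j) = inj₂ i+2≤j
apart-sym (inj₂ j+2≤i) = inj₁ j+2≤i

swapVal-fixes-apart : ∀ {i j} → Apart i j → swapVal j i ≡ i × swapVal j (suc i) ≡ suc i
swapVal-fixes-apart {i} {j} (inj₁ i+2≤j) = swapVal-below (<-trans (n<1+n i) i+1<j) , swapVal-below i+1<j
  where i+1<j : suc i < j
        i+1<j = subst (_≤ j) (+-comm i 2) i+2≤j
swapVal-fixes-apart {i} {j} (inj₂ j+2≤i) = swapVal-above j+1<i , swapVal-above (m<n⇒m<1+n j+1<i)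
  where j+1<i : suc j < i
        j+1<i = subst (_≤ i) (+-comm j 2) j+2≤i

swapVal-comm : ∀ {i j} → Apart i j → ∀ x → swapVal i (swapVal j x) ≡ swapVal j (swapVal i x)
swapVal-comm {i} {j} apart x with swapVal-fixes-apart apart | swapVal-fixes-apart (apart-sym apart)
... | ji≡i , ji+1≡i+1 | ij≡j , ij+1≡j+1 with swapView i x | swapView j x
... | lower refl  | _          rewrite ji≡i     | swapVal-lower i = sym ji+1≡i+1
... | upper refl  | _          rewrite ji+1≡i+1 | swapVal-upper i = sym ji≡i
... | outside _ _ | lower refl rewrite ij≡j     | swapVal-lower j = ij+1≡j+1
... | outside _ _ | upper refl rewrite ij+1≡j+1 | swapVal-upper j = ij≡j
... | outside x≢i x≢i+1 | outside x≢j x≢j+1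
    rewrite swapVal-outside x≢i x≢i+1 | swapVal-outside x≢j x≢j+1 = swapVal-outside x≢i x≢i+1

swapVal-chain : ∀ k l m x {y z w} → swapVal k x ≡ y → swapVal l y ≡ z → swapVal m z ≡ w →
                swapVal m (swapVal l (swapVal k x)) ≡ w
swapVal-chain _ _ _ _ refl refl refl = refl

swapVal-braid : ∀ i x → swapVal i (swapVal (suc i) (swapVal i x))
                      ≡ swapVal (suc i) (swapVal i (swapVal (suc i) x))
swapVal-braid i x with swapView i x | swapView (suc i) x
... | lower refl | _ =
  trans (swapVal-chain i (suc i) i i (swapVal-lower i) (swapVal-lower (suc i)) (swapVal-above (n<1+n (suc i))))
   (sym (swapVal-chain (suc i) i (suc i) i (swapVal-below (n<1+n i)) (swapVal-lower i) (swapVal-lower (suc i))))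
... | upper refl | _ =
  trans (swapVal-chain i (suc i) i (suc i) (swapVal-upper i) (swapVal-below (n<1+n i)) (swapVal-lower i))
   (sym (swapVal-chain (suc i) i (suc i) (suc i)
          (swapVal-lower (suc i)) (swapVal-above (n<1+n (suc i))) (swapVal-upper (suc i))))
... | outside _ _ | upper refl =
  trans (swapVal-chain i (suc i) i (suc (suc i))
          (swapVal-above (n<1+n (suc i))) (swapVal-upper (suc i)) (swapVal-upper i))
   (sym (swapVal-chain (suc i) i (suc i) (suc (suc i))
          (swapVal-upper (suc i)) (swapVal-upper i) (swapVal-below (n<1+n i))))
... | outside _ x≢i+1 | lower x≡i+1 = ⊥-elim (x≢i+1 x≡i+1)
... | outside x≢i x≢i+1 | outside _ x≢i+2 =
  trans (swapVal-chain i (suc i) i x fixᵢ fixᵢ₊₁ fixᵢ)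
   (sym (swapVal-chain (suc i) i (suc i) x fixᵢ₊₁ fixᵢ fixᵢ₊₁))
  where fixᵢ : swapVal i x ≡ x
        fixᵢ = swapVal-outside x≢i x≢i+1
        fixᵢ₊₁ : swapVal (suc i) x ≡ x
        fixᵢ₊₁ = swapVal-outside x≢i+1 x≢i+2

≡ᵇ-swapVal : ∀ k x v → (swapVal k x ≡ᵇ v) ≡ (x ≡ᵇ swapVal k v)
≡ᵇ-swapVal k x v with x ≟ swapVal k v
... | yes x≡kv =
  trans (≡ᵇ-true (trans (cong (swapVal k) x≡kv) (swapVal-involutive k v))) (sym (≡ᵇ-true x≡kv))
... | no x≢kv  = trans (≡ᵇ-false (x≢kv ∘ kx≡v⇒x≡kv)) (sym (≡ᵇ-false x≢kv))
  where kx≡v⇒x≡kv : swapVal k x ≡ v → x ≡ swapVal k v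
        kx≡v⇒x≡kv kx≡v = trans (sym (swapVal-involutive k x)) (cong (swapVal k) kx≡v)

relabel-∘ : ∀ (f g : ℕ → ℕ) (τ : Filling) → map (map f) (map (map g) τ) ≡ map (map (f ∘ g)) τ
relabel-∘ f g τ = trans (sym (map-∘ τ)) (map-cong (λ row → sym (map-∘ row)) τ)

relabel-cong : ∀ {f g : ℕ → ℕ} → f ≗ g → ∀ (τ : Filling) → map (map f) τ ≡ map (map g) τ
relabel-cong f≗g = map-cong (map-cong f≗g)

relabel-id : ∀ {f : ℕ → ℕ} → f ≗ id → ∀ (τ : Filling) → map (map f) τ ≡ τ
relabel-id f≗id τ = trans (relabel-cong f≗id τ) (trans (map-cong map-id τ) (map-id τ))

sOp-involutive : ∀ k τ → sOp k (sOp k τ) ≡ τ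
sOp-involutive k τ = trans (relabel-∘ _ _ τ) (relabel-id (swapVal-involutive k) τ)

sOp-comm : ∀ {i j} → Apart i j → ∀ τ → sOp i (sOp j τ) ≡ sOp j (sOp i τ)
sOp-comm {i} {j} apart τ = begin
  sOp i (sOp j τ)                      ≡⟨ relabel-∘ _ _ τ ⟩
  map (map (swapVal i ∘ swapVal j)) τ  ≡⟨ relabel-cong (swapVal-comm apart) τ ⟩
  map (map (swapVal j ∘ swapVal i)) τ  ≡⟨ relabel-∘ _ _ τ ⟨
  sOp j (sOp i τ)                      ∎
  where open ≡-Reasoning

sOp-braid : ∀ i τ → sOp i (sOp (suc i) (sOp i τ)) ≡ sOp (suc i) (sOp i (sOp (suc i) τ))
sOp-braid i τ = begin
  sOp i (sOp i₁ (sOp i τ))                          ≡⟨ cong (sOp i) (relabel-∘ _ _ τ) ⟩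
  sOp i (map (map (swapVal i₁ ∘ swapVal i)) τ)      ≡⟨ relabel-∘ _ _ τ ⟩
  map (map (swapVal i ∘ swapVal i₁ ∘ swapVal i)) τ  ≡⟨ relabel-cong (swapVal-braid i) τ ⟩
  map (map (swapVal i₁ ∘ swapVal i ∘ swapVal i₁)) τ ≡⟨ relabel-∘ _ _ τ ⟨
  sOp i₁ (map (map (swapVal i ∘ swapVal i₁)) τ)     ≡⟨ cong (sOp i₁) (relabel-∘ _ _ τ) ⟨
  sOp i₁ (sOp i (sOp i₁ τ))                         ∎
  where open ≡-Reasoning
        i₁ : ℕ
        i₁ = suc i

findIdx-swapVal : ∀ k v row →
                  findIdx (λ x → x ≡ᵇ v) (map (swapVal k) row) ≡ findIdx (λ x → x ≡ᵇ swapVal k v) row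
findIdx-swapVal k v []        = refl
findIdx-swapVal k v (x ∷ row) rewrite ≡ᵇ-swapVal k x v | findIdx-swapVal k v row = refl

pos-sOp : ∀ k v τ → pos v (sOp k τ) ≡ pos (swapVal k v) τ
pos-sOp k v []           = refl
pos-sOp k v (row ∷ rows) rewrite findIdx-swapVal k v row with findIdx (λ x → x ≡ᵇ swapVal k v) row
... | just c  = refl
... | nothing rewrite pos-sOp k v rows = refl

pos-sOp-lower : ∀ k τ → pos k (sOp k τ) ≡ pos (suc k) τ
pos-sOp-lower k τ = trans (pos-sOp k k τ) (cong (λ v → pos v τ) (swapVal-lower k))

pos-sOp-upper : ∀ k τ → pos (suc k) (sOp k τ) ≡ pos k τ
pos-sOp-upper k τ = trans (pos-sOp k (suc k) τ) (cong (λ v → pos v τ) (swapVal-upper k))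

pos-sOp-apart : ∀ {k l} → Apart k l → ∀ τ →
                pos k (sOp l τ) ≡ pos k τ × pos (suc k) (sOp l τ) ≡ pos (suc k) τ
pos-sOp-apart {k} {l} apart τ =
  trans (pos-sOp l k τ) (cong (λ v → pos v τ) (proj₁ (swapVal-fixes-apart apart))) ,
  trans (pos-sOp l (suc k) τ) (cong (λ v → pos v τ) (proj₂ (swapVal-fixes-apart apart)))

at-∈ : ∀ (xs : List ℕ) {c v} → at xs c ≡ just v → v ∈ xs
at-∈ (x ∷ xs) {zero}  refl = here refl
at-∈ (x ∷ xs) {suc c} eq   = there (at-∈ xs eq)

∈⇒at : ∀ {v} (xs : List ℕ) → v ∈ xs → ∃ λ c → at xs c ≡ just v
∈⇒at (x ∷ xs) (here refl)  = 0 , refl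
∈⇒at (x ∷ xs) (there v∈xs) = let c , eq = ∈⇒at xs v∈xs in suc c , eq

entry-∈ : ∀ τ {r c v} → entry τ r c ≡ just v → v ∈ concat τ
entry-∈ (row ∷ rows) {zero}  eq = ∈-++⁺ˡ (at-∈ row eq)
entry-∈ (row ∷ rows) {suc r} eq = ∈-++⁺ʳ row (entry-∈ rows eq)

∈⇒entry : ∀ {v} τ → v ∈ concat τ → ∃ λ P → entry τ (proj₁ P) (proj₂ P) ≡ just v
∈⇒entry (row ∷ rows) v∈ with ∈-++⁻ row v∈
... | inj₁ v∈row  = let c , eq = ∈⇒at row v∈row in (0 , c) , eq
... | inj₂ v∈rows = let (r , c) , eq = ∈⇒entry rows v∈rows in (suc r , c) , eq

at-map : ∀ (f : ℕ → ℕ) xs c → at (map f xs) c ≡ Maybe.map f (at xs c)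
at-map f []       c       = refl
at-map f (x ∷ xs) zero    = refl
at-map f (x ∷ xs) (suc c) = at-map f xs c

entry-sOp : ∀ k τ r c → entry (sOp k τ) r c ≡ Maybe.map (swapVal k) (entry τ r c)
entry-sOp k []           r       c = refl
entry-sOp k (row ∷ rows) zero    c = at-map (swapVal k) row c
entry-sOp k (row ∷ rows) (suc r) c = entry-sOp k rows r c

entry-sOp⁻ : ∀ k τ {r c a} → entry (sOp k τ) r c ≡ just a → entry τ r c ≡ just (swapVal k a)
entry-sOp⁻ k τ {r} {c} eq with entry τ r c | entry-sOp k τ r c
... | just b  | eq′ = cong just (trans (sym (swapVal-involutive k b))
                                        (cong (swapVal k) (Maybe.just-injective (trans (sym eq′) eq))))
... | nothing | eq′ with () ← trans (sym eq′) eq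

Unique-++⁻ : ∀ (xs : List ℕ) {ys} → Unique (xs ++ ys) →
             Unique xs × Unique ys × (∀ {v} → v ∈ xs → v ∉ ys)
Unique-++⁻ []       u        = [] , u , λ ()
Unique-++⁻ (x ∷ xs) (x∉ ∷ u) with Unique-++⁻ xs u
... | uxs , uys , disjoint = All.++⁻ˡ xs x∉ ∷ uxs , uys , λ
  { (here refl) v∈ys → All.lookup x∉ (∈-++⁺ʳ xs v∈ys) refl
  ; (there v∈xs)     → disjoint v∈xs }

findIdx-∉ : ∀ {v} row → v ∉ row → findIdx (λ x → x ≡ᵇ v) row ≡ nothing
findIdx-∉ []        _  = refl
findIdx-∉ (x ∷ row) v∉
  rewrite ≡ᵇ-false (λ x≡v → v∉ (here (sym x≡v))) | findIdx-∉ row (v∉ ∘ there) = refl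

findIdx-unique : ∀ (row : List ℕ) {c v} → Unique row → at row c ≡ just v →
                 findIdx (λ x → x ≡ᵇ v) row ≡ just c
findIdx-unique (x ∷ row) {zero}  _        refl rewrite ≡ᵇ-true {x} refl = refl
findIdx-unique (x ∷ row) {suc c} (x∉ ∷ u) eq
  rewrite ≡ᵇ-false (All.lookup x∉ (at-∈ row eq)) | findIdx-unique row u eq = refl

entry⇒pos : ∀ τ {r c v} → Unique (concat τ) → entry τ r c ≡ just v → pos v τ ≡ just (r , c)
entry⇒pos (row ∷ rows) {zero} u eq with Unique-++⁻ row u
... | urow , _ , _ rewrite findIdx-unique row urow eq = refl
entry⇒pos (row ∷ rows) {suc r} u eq with Unique-++⁻ row u
... | _ , urows , disjoint
  rewrite findIdx-∉ row (λ v∈row → disjoint v∈row (entry-∈ rows eq)) | entry⇒pos rows urows eq = refl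

applyUpTo-iterate : ∀ (f : ℕ → ℕ) n → (∀ x → f (suc x) ≡ suc (f x)) →
                    applyUpTo f n ≡ iterate suc (f 0) n
applyUpTo-iterate f zero    f-suc = refl
applyUpTo-iterate f (suc n) f-suc =
  cong (f 0 ∷_) (trans (applyUpTo-iterate (f ∘ suc) n (f-suc ∘ suc))
                       (cong (λ a → iterate suc a n) (f-suc 0)))

upTo-iterate : ∀ n → map suc (upTo n) ≡ iterate suc 1 n
upTo-iterate n = trans (map-upTo suc n) (applyUpTo-iterate suc n (λ _ → refl))

∈-iterate : ∀ {a v} k → a ≤ v → v < a + k → v ∈ iterate suc a k
∈-iterate {a} {v} zero    a≤v v<a+0 = ⊥-elim (<⇒≱ (subst (v <_) (+-identityʳ a) v<a+0) a≤v)
∈-iterate {a} {v} (suc k) a≤v v<a+k+1 with a ≟ v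
... | yes refl = here refl
... | no a≢v   = there (∈-iterate k (≤∧≢⇒< a≤v a≢v) (subst (v <_) (+-suc a k) v<a+k+1))

iterate-swapVal-above : ∀ {i a} k → suc (suc i) ≤ a → map (swapVal i) (iterate suc a k) ≡ iterate suc a k
iterate-swapVal-above zero    _     = refl
iterate-swapVal-above (suc k) i+2≤a =
  cong₂ _∷_ (swapVal-above i+2≤a) (iterate-swapVal-above k (m≤n⇒m≤1+n i+2≤a))

iterate-swapVal : ∀ {i a} k → a ≤ i → suc (suc i) ≤ a + k →
                  map (swapVal i) (iterate suc a k) ↭ iterate suc a k
iterate-swapVal {i} {a} zero a≤i i+2≤a+0 =
  ⊥-elim (<⇒≱ (subst (suc i <_) (+-identityʳ a) i+2≤a+0) (m≤n⇒m≤1+n a≤i))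
iterate-swapVal {i} {a} (suc k) a≤i i+2≤a+k+1 with a ≟ i
... | no a≢i rewrite swapVal-below (≤∧≢⇒< a≤i a≢i) =
  prep a (iterate-swapVal k (≤∧≢⇒< a≤i a≢i) (subst (suc (suc i) ≤_) (+-suc a k) i+2≤a+k+1))
iterate-swapVal {i} (suc zero)    _ i+2≤i+1 | yes refl =
  ⊥-elim (<⇒≱ (subst (suc i <_) (+-comm i 1) i+2≤i+1) ≤-refl)
iterate-swapVal {i} (suc (suc k)) _ _       | yes refl
  rewrite swapVal-lower i | swapVal-upper i | iterate-swapVal-above {i} k ≤-refl = ↭-swap (suc i) i ↭-refl

module _ {α σ τ} (T : IsSPCT α σ τ) where
  open IsSPCT T

  IsSPCT-unique : Unique (concat τ)
  IsSPCT-unique =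
    Unique-resp-↭ (setoid ℕ) (↭⇒↭ₛ (↭-sym standard)) (Unique.map⁺ suc-injective (Unique.upTo⁺ (sum α)))

  IsSPCT-pos : ∀ {v} → 1 ≤ v → v ≤ sum α → ∃ λ P → pos v τ ≡ just P
  IsSPCT-pos {v} 1≤v v≤n =
    let P , eq = ∈⇒entry τ (↭.∈-resp-↭ (↭-sym standard)
                   (subst (v ∈_) (sym (upTo-iterate (sum α))) (∈-iterate (sum α) 1≤v (s≤s v≤n))))
    in P , entry⇒pos τ IsSPCT-unique eq

Cell : Set
Cell = ℕ × ℕ

data Outcome : Set where
  keep kill swap : Outcome

outcome : Cell → Cell → Outcome
outcome (r , c) (r′ , c′) =
  if c ≤ᵇ c′ then (if (c ≡ᵇ c′) ∨ ((c′ ≡ᵇ suc c) ∧ (r <ᵇ r′)) then kill else swap) else keep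

act : ℕ → Outcome → Filling → Maybe Filling
act k keep τ = just τ
act k kill τ = nothing
act k swap τ = just (sOp k τ)

πOp-outcome : ∀ {k τ P Q} → pos k τ ≡ just P → pos (suc k) τ ≡ just Q →
              πOp k τ ≡ act k (outcome P Q) τ
πOp-outcome {k} {τ} {r , c} {r′ , c′} posₖ posₖ₊₁ rewrite posₖ | posₖ₊₁ with c ≤ᵇ c′
... | false = refl
... | true with (c ≡ᵇ c′) ∨ ((c′ ≡ᵇ suc c) ∧ (r <ᵇ r′))
...   | true  = refl
...   | false = refl

-- The position of the first cell of a pair relative to the second; it determines the outcome
-- of π on the pair in both orders (forward and backward).
data Comparison : Set where
  sameColumn     : Comparison
  leftOf rightOf : (attacking : Bool) → Comparison

compareCells : Cell → Cell → Comparison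
compareCells (r , c) (r′ , c′) with <-cmp c c′
... | tri< _ _ _ = leftOf ((c′ ≡ᵇ suc c) ∧ (r <ᵇ r′))
... | tri≈ _ _ _ = sameColumn
... | tri> _ _ _ = rightOf ((c ≡ᵇ suc c′) ∧ (r′ <ᵇ r))

forward backward : Comparison → Outcome
forward sameColumn           = kill
forward (leftOf attacking)   = if attacking then kill else swap
forward (rightOf _)          = keep
backward sameColumn          = kill
backward (leftOf _)          = keep
backward (rightOf attacking) = if attacking then kill else swap

outcome-forward : ∀ P Q → outcome P Q ≡ forward (compareCells P Q)
outcome-forward (r , c) (r′ , c′) with <-cmp c c′
... | tri< c<c′ c≢c′ _ rewrite ≤ᵇ-true (<⇒≤ c<c′) | ≡ᵇ-false c≢c′ = refl
... | tri≈ _ refl _    rewrite ≤ᵇ-true (≤-refl {c}) | ≡ᵇ-true {c} refl = refl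
... | tri> _ _ c′<c    rewrite ≤ᵇ-false c′<c = refl

outcome-backward : ∀ P Q → outcome Q P ≡ backward (compareCells P Q)
outcome-backward (r , c) (r′ , c′) with <-cmp c c′
... | tri< c<c′ _ _    rewrite ≤ᵇ-false c<c′ = refl
... | tri≈ _ refl _    rewrite ≤ᵇ-true (≤-refl {c}) | ≡ᵇ-true {c} refl = refl
... | tri> _ c≢c′ c′<c rewrite ≤ᵇ-true (<⇒≤ c′<c) | ≡ᵇ-false (≢-sym c≢c′) = refl

outcome-diagonal : ∀ P → outcome P P ≡ kill
outcome-diagonal (r , c) rewrite ≤ᵇ-true (≤-refl {c}) | ≡ᵇ-true {c} refl = refl

swap-reverses : ∀ x → forward x ≡ swap → backward x ≡ keep
swap-reverses (leftOf _)  _  = refl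
swap-reverses sameColumn  ()
swap-reverses (rightOf _) ()

outcome-swap-reverses : ∀ P Q → outcome P Q ≡ swap → outcome Q P ≡ keep
outcome-swap-reverses P Q sw =
  trans (outcome-backward P Q) (swap-reverses (compareCells P Q) (trans (sym (outcome-forward P Q)) sw))

swap⇒left-not-attacking : ∀ {r c r′ c′} → outcome (r , c) (r′ , c′) ≡ swap →
                          c < c′ × ¬ (c′ ≡ suc c × r < r′)
swap⇒left-not-attacking {r} {c} {r′} {c′} sw = geometry (trans (sym (outcome-forward (r , c) (r′ , c′))) sw)
  where
  geometry : forward (compareCells (r , c) (r′ , c′)) ≡ swap → c < c′ × ¬ (c′ ≡ suc c × r < r′)
  geometry fw with <-cmp c c′
  ... | tri< c<c′ _ _ = c<c′ , λ (adjacent , r<r′) → kill≢swap (trans (sym (attacked adjacent r<r′)) fw)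
    where
    kill≢swap : kill ≢ swap
    kill≢swap ()
    attacked : c′ ≡ suc c → r < r′ → forward (leftOf ((c′ ≡ᵇ suc c) ∧ (r <ᵇ r′))) ≡ kill
    attacked adjacent r<r′ rewrite ≡ᵇ-true adjacent | T⇒≡true (<⇒<ᵇ r<r′) = refl
  ... | tri≈ _ _ _ with () ← fw
  ... | tri> _ _ _ with () ← fw

-- π_k preserves SPCT^σ(α)

module _ {α σ τ i rP cP rQ cQ} (T : IsSPCT α σ τ)
         (posᵢ : pos i τ ≡ just (rP , cP)) (posᵢ₊₁ : pos (suc i) τ ≡ just (rQ , cQ))
         (sw : outcome (rP , cP) (rQ , cQ) ≡ swap) where
  open IsSPCT T

  private
    f : ℕ → ℕ
    f = swapVal i

    τ′ : Filling
    τ′ = sOp i τ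

    cP<cQ : cP < cQ
    cP<cQ = proj₁ (swap⇒left-not-attacking {rP} {cP} {rQ} {cQ} sw)

    not-attacking : ¬ (cQ ≡ suc cP × rP < rQ)
    not-attacking = proj₂ (swap⇒left-not-attacking {rP} {cP} {rQ} {cQ} sw)

    holds-i : ∀ {r c} → entry τ r c ≡ just i → (r , c) ≡ (rP , cP)
    holds-i e = Maybe.just-injective (trans (sym (entry⇒pos τ (IsSPCT-unique T) e)) posᵢ)

    holds-i+1 : ∀ {r c} → entry τ r c ≡ just (suc i) → (r , c) ≡ (rQ , cQ)
    holds-i+1 e = Maybe.just-injective (trans (sym (entry⇒pos τ (IsSPCT-unique T) e)) posᵢ₊₁)

    old : ∀ {r c a} → entry τ′ r c ≡ just a → entry τ r c ≡ just (f a)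
    old = entry-sOp⁻ i τ

    new<⇒old< : ∀ {r c r′ c′ a b} → entry τ′ r c ≡ just a → entry τ′ r′ c′ ≡ just b → a < b →
                ¬ ((r , c) ≡ (rQ , cQ) × (r′ , c′) ≡ (rP , cP)) → f a < f b
    new<⇒old< ea eb a<b not-QP = swapVal-<-mono i a<b λ where
      (refl , refl) → not-QP (holds-i+1 (subst (λ v → _ ≡ just v) (swapVal-lower i) (old ea)) ,
                              holds-i (subst (λ v → _ ≡ just v) (swapVal-upper i) (old eb)))

    old<⇒new< : ∀ {r c r′ c′ a b} → entry τ′ r c ≡ just a → entry τ′ r′ c′ ≡ just b → f a < f b →
                ¬ ((r , c) ≡ (rP , cP) × (r′ , c′) ≡ (rQ , cQ)) → a < b
    old<⇒new< {a = a} {b} ea eb fa<fb not-PQ =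
      subst₂ _<_ (swapVal-involutive i a) (swapVal-involutive i b) (swapVal-<-mono i fa<fb λ where
        (fa≡i , fb≡i+1) → not-PQ (holds-i (subst (λ v → _ ≡ just v) fa≡i (old ea)) ,
                                  holds-i+1 (subst (λ v → _ ≡ just v) fb≡i+1 (old eb))))

    column-distinct : ∀ {r r′ c} → ¬ ((r , c) ≡ (rP , cP) × (r′ , c) ≡ (rQ , cQ))
    column-distinct (refl , refl) = <-irrefl refl cP<cQ

  IsSPCT-sOp : 1 ≤ i → suc i ≤ sum α → IsSPCT α σ τ′
  IsSPCT-sOp 1≤i i<n = record
    { shape         = trans (sym (map-∘ τ)) (trans (map-cong (length-map f) τ) shape)
    ; standard      = standard′
    ; firstDistinct = λ I J a b I<J ea eb a≡b →
        firstDistinct I J (f a) (f b) I<J (old ea) (old eb) (cong f a≡b)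
    ; firstStan     = λ I J a b I<J ea eb →
        let stan = firstStan I J (f a) (f b) I<J (old ea) (old eb)
        in mk⇔ (λ σ< → old<⇒new< eb ea (Equivalence.to stan σ<) column-distinct)
               (λ b<a → Equivalence.from stan (new<⇒old< eb ea b<a λ (q , p) → column-distinct (p , q)))
    ; rowsDecr      = λ r c a b ea eb → ≮⇒≥ λ a<b →
        <⇒≱ (new<⇒old< ea eb a<b λ { (refl , refl) → <-asym (n<1+n c) cP<cQ })
            (rowsDecr r c (f a) (f b) (old ea) (old eb))
    ; triple        = λ I R j a b c I<R ea eb ec c≤a →
        let fc≤fa = ≮⇒≥ λ fa<fc →
              <⇒≱ (old<⇒new< ea ec fa<fc λ { (refl , refl) → not-attacking (refl , I<R) }) c≤a
        in old<⇒new< ec eb (triple I R j (f a) (f b) (f c) I<R (old ea) (old eb) (old ec) fc≤fa) column-distinct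
    }
    where
    open PermutationReasoning
    n : ℕ
    n = sum α
    standard′ : concat τ′ ↭ map suc (upTo n)
    standard′ = begin
      concat τ′                 ≡⟨ concat-map τ ⟩
      map f (concat τ)          ↭⟨ ↭.map⁺ f standard ⟩
      map f (map suc (upTo n))  ≡⟨ cong (map f) (upTo-iterate n) ⟩
      map f (iterate suc 1 n)   ↭⟨ iterate-swapVal n 1≤i (s≤s i<n) ⟩
      iterate suc 1 n           ≡⟨ upTo-iterate n ⟨
      map suc (upTo n)          ∎

π-closed : ∀ {α σ τ τ′ i} → IsSPCT α σ τ → 1 ≤ i → suc i ≤ sum α →
           πOp i τ ≡ just τ′ → IsSPCT α σ τ′
π-closed {τ = τ} {i = i} T 1≤i i<n πτ
  with IsSPCT-pos T 1≤i (≤-trans (n≤1+n i) i<n) | IsSPCT-pos T (s≤s z≤n) i<n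
... | P , posᵢ | Q , posᵢ₊₁ with outcome P Q in o | trans (sym (πOp-outcome {i} {τ} posᵢ posᵢ₊₁)) πτ
...   | keep | refl = T
...   | swap | refl = IsSPCT-sOp T posᵢ posᵢ₊₁ o 1≤i i<n

-- Idempotence and commutation

π-idempotent : ∀ {k τ P Q} → pos k τ ≡ just P → pos (suc k) τ ≡ just Q →
               (πOp k ∘π πOp k) τ ≡ πOp k τ
π-idempotent {k} {τ} {P} {Q} posₖ posₖ₊₁ with outcome P Q in o | πOp-outcome {k} {τ} posₖ posₖ₊₁
... | keep | πτ rewrite πτ = πτ
... | kill | πτ rewrite πτ = refl
... | swap | πτ rewrite πτ =
  trans (πOp-outcome (trans (pos-sOp-lower k τ) posₖ₊₁) (trans (pos-sOp-upper k τ) posₖ))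
        (cong (λ o′ → act k o′ (sOp k τ)) (outcome-swap-reverses P Q o))

act-bind-cong : ∀ {k τ} o {g h : Filling → Maybe Filling} → g τ ≡ h τ → g (sOp k τ) ≡ h (sOp k τ) →
                (act k o τ >>= g) ≡ (act k o τ >>= h)
act-bind-cong keep gτ≡hτ _      = gτ≡hτ
act-bind-cong kill _     _      = refl
act-bind-cong swap _     gτ′≡hτ′ = gτ′≡hτ′

act-comm : ∀ {i j} → Apart i j → ∀ oᵢ oⱼ τ →
           (act j oⱼ τ >>= act i oᵢ) ≡ (act i oᵢ τ >>= act j oⱼ)
act-comm apart keep keep τ = refl
act-comm apart keep kill τ = refl
act-comm apart keep swap τ = refl
act-comm apart kill keep τ = refl
act-comm apart kill kill τ = refl
act-comm apart kill swap τ = refl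
act-comm apart swap keep τ = refl
act-comm apart swap kill τ = refl
act-comm apart swap swap τ = cong just (sOp-comm apart τ)

π-comm : ∀ {i j τ P Q R S} → Apart i j →
         pos i τ ≡ just P → pos (suc i) τ ≡ just Q → pos j τ ≡ just R → pos (suc j) τ ≡ just S →
         (πOp i ∘π πOp j) τ ≡ (πOp j ∘π πOp i) τ
π-comm {i} {j} {τ} {P} {Q} {R} {S} apart posᵢ posᵢ₊₁ posⱼ posⱼ₊₁ = begin
  (πOp j τ >>= πOp i)                              ≡⟨ cong (_>>= πOp i) πⱼ ⟩
  (act j (outcome R S) τ >>= πOp i)                ≡⟨ act-bind-cong (outcome R S) πᵢ πᵢ-after-sⱼ ⟩
  (act j (outcome R S) τ >>= act i (outcome P Q))  ≡⟨ act-comm apart (outcome P Q) (outcome R S) τ ⟩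
  (act i (outcome P Q) τ >>= act j (outcome R S))  ≡⟨ act-bind-cong (outcome P Q) πⱼ πⱼ-after-sᵢ ⟨
  (act i (outcome P Q) τ >>= πOp j)                ≡⟨ cong (_>>= πOp j) πᵢ ⟨
  (πOp i τ >>= πOp j)                              ∎
  where
  open ≡-Reasoning
  πᵢ : πOp i τ ≡ act i (outcome P Q) τ
  πᵢ = πOp-outcome posᵢ posᵢ₊₁
  πⱼ : πOp j τ ≡ act j (outcome R S) τ
  πⱼ = πOp-outcome posⱼ posⱼ₊₁
  πᵢ-after-sⱼ : πOp i (sOp j τ) ≡ act i (outcome P Q) (sOp j τ)
  πᵢ-after-sⱼ = let fixedᵢ , fixedᵢ₊₁ = pos-sOp-apart apart τ
                in πOp-outcome (trans fixedᵢ posᵢ) (trans fixedᵢ₊₁ posᵢ₊₁)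
  πⱼ-after-sᵢ : πOp j (sOp i τ) ≡ act j (outcome R S) (sOp i τ)
  πⱼ-after-sᵢ = let fixedⱼ , fixedⱼ₊₁ = pos-sOp-apart (apart-sym apart) τ
                in πOp-outcome (trans fixedⱼ posⱼ) (trans fixedⱼ₊₁ posⱼ₊₁)

-- The braid relation in a finite model

-- A state w, written as a reduced word of S₃, stands for the filling τ relabelled by w; the
-- labels ℓ₀ ℓ₁ ℓ₂ name the cells of the values i, i+1, i+2 in τ, and holders w lists the cells
-- that hold i, i+1, i+2 in the relabelled filling.
data Label : Set where
  ℓ₀ ℓ₁ ℓ₂ : Label

data S₃ : Set where
  e s₁ s₂ s₁s₂ s₂s₁ s₁s₂s₁ : S₃

holders : S₃ → Label × Label × Label
holders e      = ℓ₀ , ℓ₁ , ℓ₂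
holders s₁     = ℓ₁ , ℓ₀ , ℓ₂
holders s₂     = ℓ₀ , ℓ₂ , ℓ₁
holders s₁s₂   = ℓ₂ , ℓ₀ , ℓ₁
holders s₂s₁   = ℓ₁ , ℓ₂ , ℓ₀
holders s₁s₂s₁ = ℓ₂ , ℓ₁ , ℓ₀

s₁· s₂· : S₃ → S₃
s₁· e      = s₁
s₁· s₁     = e
s₁· s₂     = s₁s₂
s₁· s₁s₂   = s₂
s₁· s₂s₁   = s₁s₂s₁
s₁· s₁s₂s₁ = s₂s₁
s₂· e      = s₂
s₂· s₁     = s₂s₁
s₂· s₂     = e
s₂· s₁s₂   = s₁s₂s₁
s₂· s₂s₁   = s₁
s₂· s₁s₂s₁ = s₁s₂

swap₀₁ swap₁₂ : ∀ {A : Set} → A × A × A → A × A × A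
swap₀₁ (x , y , z) = y , x , z
swap₁₂ (x , y , z) = x , z , y

holders-s₁· : ∀ w → holders (s₁· w) ≡ swap₀₁ (holders w)
holders-s₁· e      = refl
holders-s₁· s₁     = refl
holders-s₁· s₂     = refl
holders-s₁· s₁s₂   = refl
holders-s₁· s₂s₁   = refl
holders-s₁· s₁s₂s₁ = refl

holders-s₂· : ∀ w → holders (s₂· w) ≡ swap₁₂ (holders w)
holders-s₂· e      = refl
holders-s₂· s₁     = refl
holders-s₂· s₂     = refl
holders-s₂· s₁s₂   = refl
holders-s₂· s₂s₁   = refl
holders-s₂· s₁s₂s₁ = refl

index : S₃ → ℕ
index e      = 0
index s₁     = 1
index s₂     = 2
index s₁s₂   = 3
index s₂s₁   = 4
index s₁s₂s₁ = 5

fromIndex : ℕ → S₃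
fromIndex 0 = e
fromIndex 1 = s₁
fromIndex 2 = s₂
fromIndex 3 = s₁s₂
fromIndex 4 = s₂s₁
fromIndex _ = s₁s₂s₁

fromIndex-index : ∀ w → fromIndex (index w) ≡ w
fromIndex-index e      = refl
fromIndex-index s₁     = refl
fromIndex-index s₂     = refl
fromIndex-index s₁s₂   = refl
fromIndex-index s₂s₁   = refl
fromIndex-index s₁s₂s₁ = refl

_≟S₃_ : DecidableEquality S₃
w ≟S₃ w′ = map′ index-injective (cong index) (index w ≟ index w′)
  where index-injective : index w ≡ index w′ → w ≡ w′
        index-injective eq = trans (sym (fromIndex-index w)) (trans (cong fromIndex eq) (fromIndex-index w′))

Comparisons : Set
Comparisons = Comparison × Comparison × Comparison

between : Comparisons → Label → Label → Outcome
between (c₀₁ , _   , _  ) ℓ₀ ℓ₁ = forward c₀₁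
between (c₀₁ , _   , _  ) ℓ₁ ℓ₀ = backward c₀₁
between (_   , c₁₂ , _  ) ℓ₁ ℓ₂ = forward c₁₂
between (_   , c₁₂ , _  ) ℓ₂ ℓ₁ = backward c₁₂
between (_   , _   , c₀₂) ℓ₀ ℓ₂ = forward c₀₂
between (_   , _   , c₀₂) ℓ₂ ℓ₀ = backward c₀₂
between _ ℓ₀ ℓ₀ = kill
between _ ℓ₁ ℓ₁ = kill
between _ ℓ₂ ℓ₂ = kill

move : Outcome → S₃ → S₃ → Maybe S₃
move keep w _  = just w
move kill _ _  = nothing
move swap _ w′ = just w′

step₁ step₂ : Comparisons → S₃ → Maybe S₃
step₁ κ w = let (x , y , _) = holders w in move (between κ x y) w (s₁· w)
step₂ κ w = let (_ , y , z) = holders w in move (between κ y z) w (s₂· w)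

braidˡ braidʳ : Comparisons → Maybe S₃
braidˡ κ = (step₁ κ e >>= step₂ κ) >>= step₁ κ
braidʳ κ = (step₂ κ e >>= step₁ κ) >>= step₂ κ

isLeftOf isSameColumn isRightOf : Comparison → Bool
isLeftOf (leftOf _)     = true
isLeftOf _              = false
isSameColumn sameColumn = true
isSameColumn _          = false
isRightOf (rightOf _)   = true
isRightOf _             = false

-- The triples (c₀₁ , c₁₂ , c₀₂) that can arise from three cells: their column order is transitive.
coherent : Comparisons → Bool
coherent (leftOf _   , leftOf _   , c₀₂) = isLeftOf c₀₂
coherent (leftOf _   , sameColumn , c₀₂) = isLeftOf c₀₂
coherent (sameColumn , leftOf _   , c₀₂) = isLeftOf c₀₂
coherent (sameColumn , sameColumn , c₀₂) = isSameColumn c₀₂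
coherent (rightOf _  , rightOf _  , c₀₂) = isRightOf c₀₂
coherent (rightOf _  , sameColumn , c₀₂) = isRightOf c₀₂
coherent (sameColumn , rightOf _  , c₀₂) = isRightOf c₀₂
coherent (leftOf _   , rightOf _  , _  ) = true
coherent (rightOf _  , leftOf _   , _  ) = true

every : (Comparison → Bool) → Bool
every p = p sameColumn ∧ p (leftOf true) ∧ p (leftOf false) ∧ p (rightOf true) ∧ p (rightOf false)

every-sound : ∀ p → T (every p) → ∀ x → T (p x)
every-sound p all x with Equivalence.to T-∧ all
... | t₀ , all₁ with Equivalence.to T-∧ all₁
... | t₁ , all₂ with Equivalence.to T-∧ all₂
... | t₂ , all₃ with Equivalence.to T-∧ all₃
... | t₃ , t₄ = lookup x
  where
  lookup : ∀ x → T (p x)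
  lookup sameColumn      = t₀
  lookup (leftOf true)   = t₁
  lookup (leftOf false)  = t₂
  lookup (rightOf true)  = t₃
  lookup (rightOf false) = t₄

braids : Comparisons → Bool
braids κ = if coherent κ then isYes (Maybe.≡-dec _≟S₃_ (braidˡ κ) (braidʳ κ)) else true

-- Checked by evaluating the model on all 125 triples of comparisons.
all-braid : ∀ κ → T (braids κ)
all-braid (c₀₁ , c₁₂ , c₀₂) =
  every-sound (λ z → braids (c₀₁ , c₁₂ , z))
    (every-sound (λ y → every λ z → braids (c₀₁ , y , z))
      (every-sound (λ x → every λ y → every λ z → braids (x , y , z)) _ c₀₁) c₁₂) c₀₂

model-braid : ∀ κ → T (coherent κ) → braidˡ κ ≡ braidʳ κ
model-braid κ coh = toWitness {a? = Maybe.≡-dec _≟S₃_ (braidˡ κ) (braidʳ κ)} (guarded coh (all-braid κ))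
  where guarded : ∀ {b d} → T b → T (if b then d else true) → T d
        guarded {true} _ t = t

leftOf-if : ∀ {r c r′ c′} → c < c′ → T (isLeftOf (compareCells (r , c) (r′ , c′)))
leftOf-if {c = c} {c′ = c′} c<c′ with <-cmp c c′
... | tri< _ _ _    = _
... | tri≈ c≮c′ _ _ = c≮c′ c<c′
... | tri> c≮c′ _ _ = c≮c′ c<c′

sameColumn-if : ∀ {r c r′ c′} → c ≡ c′ → T (isSameColumn (compareCells (r , c) (r′ , c′)))
sameColumn-if {c = c} {c′ = c′} c≡c′ with <-cmp c c′
... | tri< _ c≢c′ _ = c≢c′ c≡c′
... | tri≈ _ _ _    = _
... | tri> _ c≢c′ _ = c≢c′ c≡c′

rightOf-if : ∀ {r c r′ c′} → c′ < c → T (isRightOf (compareCells (r , c) (r′ , c′)))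
rightOf-if {c = c} {c′ = c′} c′<c with <-cmp c c′
... | tri< _ _ c′≮c = c′≮c c′<c
... | tri≈ _ _ c′≮c = c′≮c c′<c
... | tri> _ _ _    = _

compareCells-coherent : ∀ P₀ P₁ P₂ →
                        T (coherent (compareCells P₀ P₁ , compareCells P₁ P₂ , compareCells P₀ P₂))
compareCells-coherent (r₀ , c₀) (r₁ , c₁) (r₂ , c₂) with <-cmp c₀ c₁ | <-cmp c₁ c₂
... | tri< c₀<c₁ _ _ | tri< c₁<c₂ _ _ = leftOf-if (<-trans c₀<c₁ c₁<c₂)
... | tri< c₀<c₁ _ _ | tri≈ _ refl _  = leftOf-if c₀<c₁
... | tri< _ _ _     | tri> _ _ _     = _
... | tri≈ _ refl _  | tri< c₁<c₂ _ _ = leftOf-if c₁<c₂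
... | tri≈ _ refl _  | tri≈ _ refl _  = sameColumn-if refl
... | tri≈ _ refl _  | tri> _ _ c₂<c₁ = rightOf-if c₂<c₁
... | tri> _ _ _     | tri< _ _ _     = _
... | tri> _ _ c₁<c₀ | tri≈ _ refl _  = rightOf-if c₁<c₀
... | tri> _ _ c₁<c₀ | tri> _ _ c₂<c₁ = rightOf-if (<-trans c₂<c₁ c₁<c₀)

-- The braid relation for fillings

module _ (i : ℕ) (τ : Filling) (P₀ P₁ P₂ : Cell) where

  cellOf : Label → Cell
  cellOf ℓ₀ = P₀
  cellOf ℓ₁ = P₁
  cellOf ℓ₂ = P₂

  cellComparisons : Comparisons
  cellComparisons = compareCells P₀ P₁ , compareCells P₁ P₂ , compareCells P₀ P₂

  outcome-between : ∀ x y → outcome (cellOf x) (cellOf y) ≡ between cellComparisons x y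
  outcome-between ℓ₀ ℓ₀ = outcome-diagonal P₀
  outcome-between ℓ₀ ℓ₁ = outcome-forward P₀ P₁
  outcome-between ℓ₀ ℓ₂ = outcome-forward P₀ P₂
  outcome-between ℓ₁ ℓ₀ = outcome-backward P₀ P₁
  outcome-between ℓ₁ ℓ₁ = outcome-diagonal P₁
  outcome-between ℓ₁ ℓ₂ = outcome-forward P₁ P₂
  outcome-between ℓ₂ ℓ₀ = outcome-backward P₀ P₂
  outcome-between ℓ₂ ℓ₁ = outcome-backward P₁ P₂
  outcome-between ℓ₂ ℓ₂ = outcome-diagonal P₂

  ⟦_⟧ : S₃ → Filling
  ⟦ e ⟧      = τ
  ⟦ s₁ ⟧     = sOp i τ
  ⟦ s₂ ⟧     = sOp (suc i) τ
  ⟦ s₁s₂ ⟧   = sOp i (sOp (suc i) τ)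
  ⟦ s₂s₁ ⟧   = sOp (suc i) (sOp i τ)
  ⟦ s₁s₂s₁ ⟧ = sOp i (sOp (suc i) (sOp i τ))

  ⟦s₁·⟧ : ∀ w → sOp i ⟦ w ⟧ ≡ ⟦ s₁· w ⟧
  ⟦s₁·⟧ e      = refl
  ⟦s₁·⟧ s₁     = sOp-involutive i τ
  ⟦s₁·⟧ s₂     = refl
  ⟦s₁·⟧ s₁s₂   = sOp-involutive i _
  ⟦s₁·⟧ s₂s₁   = refl
  ⟦s₁·⟧ s₁s₂s₁ = sOp-involutive i _

  ⟦s₂·⟧ : ∀ w → sOp (suc i) ⟦ w ⟧ ≡ ⟦ s₂· w ⟧
  ⟦s₂·⟧ e      = refl
  ⟦s₂·⟧ s₁     = refl
  ⟦s₂·⟧ s₂     = sOp-involutive (suc i) τ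
  ⟦s₂·⟧ s₁s₂   = sym (sOp-braid i τ)
  ⟦s₂·⟧ s₂s₁   = sOp-involutive (suc i) _
  ⟦s₂·⟧ s₁s₂s₁ = trans (cong (sOp (suc i)) (sOp-braid i τ)) (sOp-involutive (suc i) _)

  positions : Filling → Maybe Cell × Maybe Cell × Maybe Cell
  positions σ = pos i σ , pos (suc i) σ , pos (suc (suc i)) σ

  cellsOf : Label × Label × Label → Maybe Cell × Maybe Cell × Maybe Cell
  cellsOf (x , y , z) = just (cellOf x) , just (cellOf y) , just (cellOf z)

  positions-sOp₁ : ∀ σ → positions (sOp i σ) ≡ swap₀₁ (positions σ)
  positions-sOp₁ σ = cong₂ _,_ (pos-sOp-lower i σ) (cong₂ _,_ (pos-sOp-upper i σ)
    (trans (pos-sOp i (suc (suc i)) σ) (cong (λ v → pos v σ) (swapVal-above (n<1+n (suc i))))))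

  positions-sOp₂ : ∀ σ → positions (sOp (suc i) σ) ≡ swap₁₂ (positions σ)
  positions-sOp₂ σ =
    cong₂ _,_ (trans (pos-sOp (suc i) i σ) (cong (λ v → pos v σ) (swapVal-below (n<1+n i))))
              (cong₂ _,_ (pos-sOp-lower (suc i) σ) (pos-sOp-upper (suc i) σ))

  Located : S₃ → Set
  Located w = positions ⟦ w ⟧ ≡ cellsOf (holders w)

  located-s₁· : ∀ {w} → Located w → Located (s₁· w)
  located-s₁· {w} loc = begin
    positions ⟦ s₁· w ⟧          ≡⟨ cong positions (⟦s₁·⟧ w) ⟨
    positions (sOp i ⟦ w ⟧)      ≡⟨ positions-sOp₁ ⟦ w ⟧ ⟩
    swap₀₁ (positions ⟦ w ⟧)     ≡⟨ cong swap₀₁ loc ⟩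
    cellsOf (swap₀₁ (holders w)) ≡⟨ cong cellsOf (holders-s₁· w) ⟨
    cellsOf (holders (s₁· w))    ∎
    where open ≡-Reasoning

  located-s₂· : ∀ {w} → Located w → Located (s₂· w)
  located-s₂· {w} loc = begin
    positions ⟦ s₂· w ⟧           ≡⟨ cong positions (⟦s₂·⟧ w) ⟨
    positions (sOp (suc i) ⟦ w ⟧) ≡⟨ positions-sOp₂ ⟦ w ⟧ ⟩
    swap₁₂ (positions ⟦ w ⟧)      ≡⟨ cong swap₁₂ loc ⟩
    cellsOf (swap₁₂ (holders w))  ≡⟨ cong cellsOf (holders-s₂· w) ⟨
    cellsOf (holders (s₂· w))     ∎
    where open ≡-Reasoning

  data Simulates : Maybe S₃ → Maybe Filling → Set where
    nothing : Simulates nothing nothing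
    just    : ∀ {w} → Located w → Simulates (just w) (just ⟦ w ⟧)

  simulates-unique : ∀ {m σ σ′} → Simulates m σ → Simulates m σ′ → σ ≡ σ′
  simulates-unique nothing  nothing  = refl
  simulates-unique (just _) (just _) = refl

  simulate-move : ∀ k o {w w′} → Located w → Located w′ → sOp k ⟦ w ⟧ ≡ ⟦ w′ ⟧ →
                  Simulates (move o w w′) (act k o ⟦ w ⟧)
  simulate-move k keep loc _    _  = just loc
  simulate-move k kill _   _    _  = nothing
  simulate-move k swap _   loc′ eq rewrite eq = just loc′

  simulate₁ : ∀ {w} → Located w → Simulates (step₁ cellComparisons w) (πOp i ⟦ w ⟧)
  simulate₁ {w} loc = subst (Simulates (step₁ cellComparisons w)) (sym π≡act)
                            (simulate-move i _ {w} loc (located-s₁· {w} loc) (⟦s₁·⟧ w))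
    where
    x y : Label
    x = proj₁ (holders w)
    y = proj₁ (proj₂ (holders w))
    π≡act : πOp i ⟦ w ⟧ ≡ act i (between cellComparisons x y) ⟦ w ⟧
    π≡act = trans (πOp-outcome {i} {⟦ w ⟧} (cong proj₁ loc) (cong (proj₁ ∘ proj₂) loc))
                  (cong (λ o → act i o ⟦ w ⟧) (outcome-between x y))

  simulate₂ : ∀ {w} → Located w → Simulates (step₂ cellComparisons w) (πOp (suc i) ⟦ w ⟧)
  simulate₂ {w} loc = subst (Simulates (step₂ cellComparisons w)) (sym π≡act)
                            (simulate-move (suc i) _ {w} loc (located-s₂· {w} loc) (⟦s₂·⟧ w))
    where
    y z : Label
    y = proj₁ (proj₂ (holders w))
    z = proj₂ (proj₂ (holders w))
    π≡act : πOp (suc i) ⟦ w ⟧ ≡ act (suc i) (between cellComparisons y z) ⟦ w ⟧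
    π≡act = trans (πOp-outcome {suc i} {⟦ w ⟧} (cong (proj₁ ∘ proj₂) loc) (cong (proj₂ ∘ proj₂) loc))
                  (cong (λ o → act (suc i) o ⟦ w ⟧) (outcome-between y z))

  simulate->>= : ∀ {m σ} {f : S₃ → Maybe S₃} {g : Filling → Maybe Filling} → Simulates m σ →
                 (∀ {w} → Located w → Simulates (f w) (g ⟦ w ⟧)) → Simulates (m >>= f) (σ >>= g)
  simulate->>= nothing    _    = nothing
  simulate->>= (just loc) next = next loc

  then₁ : ∀ {m σ} → Simulates m σ → Simulates (m >>= step₁ cellComparisons) (σ >>= πOp i)
  then₁ sim = simulate->>= {f = step₁ cellComparisons} {g = πOp i} sim simulate₁

  then₂ : ∀ {m σ} → Simulates m σ → Simulates (m >>= step₂ cellComparisons) (σ >>= πOp (suc i))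
  then₂ sim = simulate->>= {f = step₂ cellComparisons} {g = πOp (suc i)} sim simulate₂

  π-braid : pos i τ ≡ just P₀ → pos (suc i) τ ≡ just P₁ → pos (suc (suc i)) τ ≡ just P₂ →
            (πOp i ∘π (πOp (suc i) ∘π πOp i)) τ ≡ (πOp (suc i) ∘π (πOp i ∘π πOp (suc i))) τ
  π-braid pos₀ pos₁ pos₂ = simulates-unique
    (subst (λ m → Simulates m _) (model-braid cellComparisons (compareCells-coherent P₀ P₁ P₂))
           (then₁ (then₂ (then₁ start))))
    (then₂ (then₁ (then₂ start)))
    where start : Simulates (just e) (just τ)
          start = just (cong₂ _,_ pos₀ (cong₂ _,_ pos₁ pos₂))

≤∸⇒+≤ : ∀ {i} n k → 1 ≤ i → i ≤ n ∸ k → k + i ≤ n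
≤∸⇒+≤ {i} n k 1≤i i≤n∸k =
  subst (_≤ n) (+-comm i k) (m≤o∸n⇒m+n≤o i (<⇒≤ (m∸n≢0⇒n<m n∸k≢0)) i≤n∸k)
  where n∸k≢0 : n ∸ k ≢ 0
        n∸k≢0 n∸k≡0 = <⇒≱ 1≤i (subst (i ≤_) n∸k≡0 i≤n∸k)

theorem3p1 : (n : ℕ) (α : List ℕ) → IsComposition n α → (σ : Permutation′ (length α)) →
      (∀ i → 1 ≤ i → i ≤ n ∸ 1 → ∀ τ τ' → IsSPCT α σ τ → πOp i τ ≡ just τ' → IsSPCT α σ τ')
    × (∀ i → 1 ≤ i → i ≤ n ∸ 1 → ∀ τ → IsSPCT α σ τ → (πOp i ∘π πOp i) τ ≡ πOp i τ)
    × (∀ i → 1 ≤ i → i ≤ n ∸ 2 → ∀ τ → IsSPCT α σ τ →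
         (πOp i ∘π (πOp (suc i) ∘π πOp i)) τ ≡ (πOp (suc i) ∘π (πOp i ∘π πOp (suc i))) τ)
    × (∀ i j → 1 ≤ i → i ≤ n ∸ 1 → 1 ≤ j → j ≤ n ∸ 1 → (i + 2 ≤ j ⊎ j + 2 ≤ i) →
         ∀ τ → IsSPCT α σ τ → (πOp i ∘π πOp j) τ ≡ (πOp j ∘π πOp i) τ)
theorem3p1 n α (_ , sumα≡n) σ =
    (λ i 1≤i i≤n∸1 _ _ T → π-closed T 1≤i (subst (suc i ≤_) (sym sumα≡n) (≤∸⇒+≤ n 1 1≤i i≤n∸1)))
  , (λ i 1≤i i≤n∸1 τ T →
       let i<n = ≤∸⇒+≤ n 1 1≤i i≤n∸1
       in π-idempotent {i} {τ} (cell T 1≤i (<⇒≤ i<n)) (cell T (s≤s z≤n) i<n))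
  , (λ i 1≤i i≤n∸2 τ T →
       let i+1<n = ≤∸⇒+≤ n 2 1≤i i≤n∸2
       in π-braid i τ _ _ _ (cell T 1≤i (≤-trans (n≤1+n i) (<⇒≤ i+1<n)))
                            (cell T (s≤s z≤n) (<⇒≤ i+1<n)) (cell T (s≤s z≤n) i+1<n))
  , (λ i j 1≤i i≤n∸1 1≤j j≤n∸1 apart τ T →
       let i<n = ≤∸⇒+≤ n 1 1≤i i≤n∸1
           j<n = ≤∸⇒+≤ n 1 1≤j j≤n∸1
       in π-comm {i} {j} {τ} apart (cell T 1≤i (<⇒≤ i<n)) (cell T (s≤s z≤n) i<n)
                                   (cell T 1≤j (<⇒≤ j<n)) (cell T (s≤s z≤n) j<n))
  where
  cell : ∀ {τ} (T : IsSPCT α σ τ) {v} (1≤v : 1 ≤ v) (v≤n : v ≤ n) →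
         pos v τ ≡ just (proj₁ (IsSPCT-pos T 1≤v (subst (v ≤_) (sym sumα≡n) v≤n)))
  cell T 1≤v v≤n = proj₂ (IsSPCT-pos T 1≤v (subst (_ ≤_) (sym sumα≡n) v≤n))
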